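{- Let $\mathcal{K}$ be the set of all positions of misère partizan Kayles. Then $S_1+S_2\equiv 0\pmod{\mathcal{K}}$.
   Context: Partizan Kayles is played on $1\times n$ strips of squares; $S_n$ denotes an empty strip of length $n$, and $0$ is the empty game (no moves for either player). Left moves by placing a single square on one empty cell; Right moves by placing a domino covering two adjacent empty cells of the same strip; a placement splits a strip into the strips of empty cells on either side. $\mathcal{K}$ is the set of all disjunctive sums of strips. Under misère play a player unable to move on their turn wins; $o^-(G)$ is the misère outcome. $G\equiv H\pmod{\mathcal{K}}$ means $o^-(G+X)=o^-(H+X)$ for all $X\in\mathcal{K}$. -}

module Defs where

open import Data.Nat using (ℕ; suc; _+_)
open import Data.List using (List; []; _∷_; _++_)
open import Data.Product using (_×_; ∃)
open import Relation.Nullary using (¬_)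
open import Relation.Binary.PropositionalEquality using (_≡_)

-- A position of partizan Kayles: a disjunctive sum of strips, given as the
-- list of strip lengths.  S n = [ n ];  sum = list append;  0 = [].
Position : Set
Position = List ℕ

S : ℕ → Position
S n = n ∷ []

_⊕_ : Position → Position → Position
G ⊕ H = G ++ H

𝟎 : Position
𝟎 = []

-- Left places a single square on an empty cell of some strip of length n,
-- splitting it into strips of lengths a and b with a + 1 + b = n.
data LeftMove : Position → Position → Set where
  here  : ∀ {n G} a b → a + suc b ≡ n → LeftMove (n ∷ G) (a ∷ b ∷ G)
  there : ∀ {n G G'} → LeftMove G G' → LeftMove (n ∷ G) (n ∷ G')

-- Right places a domino on two adjacent empty cells of some strip of length n,
-- splitting it into strips of lengths a and b with a + 2 + b = n.
data RightMove : Position → Position → Set where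
  here  : ∀ {n G} a b → a + suc (suc b) ≡ n → RightMove (n ∷ G) (a ∷ b ∷ G)
  there : ∀ {n G G'} → RightMove G G' → RightMove (n ∷ G) (n ∷ G')

-- Misère play: a player unable to move on their turn wins.
mutual
  data LeftWinsMovingFirst (G : Position) : Set where
    leftStuck : (∀ G' → ¬ LeftMove G G') → LeftWinsMovingFirst G
    leftGood  : ∀ G' → LeftMove G G' → LeftWinsMovingSecond G' → LeftWinsMovingFirst G

  data LeftWinsMovingSecond (G : Position) : Set where
    rightAllBad : ∃ (RightMove G) → (∀ G' → RightMove G G' → LeftWinsMovingFirst G')
                → LeftWinsMovingSecond G

mutual
  data RightWinsMovingFirst (G : Position) : Set where
    rightStuck : (∀ G' → ¬ RightMove G G') → RightWinsMovingFirst G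
    rightGood  : ∀ G' → RightMove G G' → RightWinsMovingSecond G' → RightWinsMovingFirst G

  data RightWinsMovingSecond (G : Position) : Set where
    leftAllBad : ∃ (LeftMove G) → (∀ G' → LeftMove G G' → RightWinsMovingFirst G')
               → RightWinsMovingSecond G

-- The misère outcome of G is determined by who wins when Left starts and who
-- wins when Right starts (finite games are determined).
_⇔_ : Set → Set → Set
A ⇔ B = (A → B) × (B → A)

SameMisereOutcome : Position → Position → Set
SameMisereOutcome G H =
  (LeftWinsMovingFirst G ⇔ LeftWinsMovingFirst H) ×
  (RightWinsMovingFirst G ⇔ RightWinsMovingFirst H)

_≡mod𝒦_ : Position → Position → Set
G ≡mod𝒦 H = ∀ (X : Position) → SameMisereOutcome (G ⊕ X) (H ⊕ X)

-- Give a strip of length n the weight 0, −1 or +1 according as n ≡ 0, 1 or 2 (mod 3), and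
-- let weight G be the total.  Every Left move changes the weight by +1 or −2 and every Right
-- move by −1 or +2.  Left can raise the weight by exactly 1 unless all strips have length 0
-- or 2, and Right can lower it by exactly 1 unless all strips have length 0 or 1.  By
-- induction on the number of empty cells, G is then an 𝒩-position when its weight is a
-- non-negative multiple of 3, a 𝒫-position when it is non-negative and ≡ 1 (mod 3), and an
-- ℛ-position otherwise.  Since S 1 ⊕ S 2 has weight −1 + 1 = 0, adding it changes nothing.
module Submission where

open import Defs
open import Data.Nat as ℕ using (ℕ; zero; suc; _<_; s≤s; z≤n)
import Data.Nat.Properties as ℕ
open import Data.Nat.Induction using (<-wellFounded)
open import Data.Integer using (ℤ; +_; -[1+_]; -_; _+_)
open import Data.Integer.Properties using (+-assoc; +-identityˡ; +-commutativeSemigroup)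
open import Algebra.Properties.CommutativeSemigroup +-commutativeSemigroup using (x∙yz≈y∙xz)
open import Data.List using ([]; _∷_)
open import Data.Nat.ListAction using (sum)
open import Data.List.Relation.Unary.All using (All; []; _∷_)
open import Data.Product using (_×_; _,_; ∃; ∃₂; ∃-syntax)
open import Data.Sum as Sum using (_⊎_; inj₁; inj₂)
open import Data.Empty using (⊥-elim)
open import Function using (_∘_)
open import Induction.WellFounded using (Acc; acc)
open import Relation.Nullary using (¬_; Dec; yes; no)
open import Relation.Nullary.Decidable using (decidable-stable)
open import Relation.Binary.PropositionalEquality
  using (_≡_; _≢_; refl; sym; trans; cong; subst; subst₂)
open Relation.Binary.PropositionalEquality.≡-Reasoning

data Outcome : Set where
  𝒩 𝒫 ℛ : Outcome

next : Outcome → Outcome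
next 𝒩 = 𝒫
next 𝒫 = ℛ
next ℛ = 𝒩

prev : Outcome → Outcome
prev 𝒩 = ℛ
prev 𝒫 = 𝒩
prev ℛ = 𝒫

prev-next : ∀ o → prev (next o) ≡ o
prev-next 𝒩 = refl
prev-next 𝒫 = refl
prev-next ℛ = refl

next-injective : ∀ {o} o′ → next o ≡ next o′ → o ≡ o′
next-injective {o} o′ e = subst₂ _≡_ (prev-next o) (prev-next o′) (cong prev e)

_≟𝒩 : ∀ o → Dec (o ≡ 𝒩)
𝒩 ≟𝒩 = yes refl
𝒫 ≟𝒩 = no λ ()
ℛ ≟𝒩 = no λ ()

outcome⁺ : ℕ → Outcome
outcome⁺ zero    = 𝒩
outcome⁺ (suc n) = next (outcome⁺ n)

-- The misère outcome class shared by all positions of weight d.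
outcome : ℤ → Outcome
outcome (+ n)    = outcome⁺ n
outcome -[1+ _ ] = ℛ

outcome-𝒩⇒𝒫[1+] : ∀ d → outcome d ≡ 𝒩 → outcome (+ 1 + d) ≡ 𝒫
outcome-𝒩⇒𝒫[1+] (+ _)    = cong next
outcome-𝒩⇒𝒫[1+] -[1+ _ ] ()

outcome-𝒫[1+]⇒𝒩 : ∀ d → outcome (+ 1 + d) ≡ 𝒫 → outcome d ≡ 𝒩
outcome-𝒫[1+]⇒𝒩 (+ _)          = next-injective 𝒩
outcome-𝒫[1+]⇒𝒩 -[1+ 0 ]       ()
outcome-𝒫[1+]⇒𝒩 -[1+ suc _ ]   ()

outcome-𝒫⇒𝒩[2+] : ∀ d → outcome d ≡ 𝒫 → outcome (+ 2 + d) ≡ 𝒩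
outcome-𝒫⇒𝒩[2+] (+ _)    = cong (next ∘ next)
outcome-𝒫⇒𝒩[2+] -[1+ _ ] ()

-- The positivity hypothesis excludes d = −2, whose outcome is ℛ although + 2 + d = 0 is 𝒩.
outcome-𝒩[2+]⇒𝒫 : ∀ d {k} → + 2 + d ≡ + suc k → outcome (+ 2 + d) ≡ 𝒩 → outcome d ≡ 𝒫
outcome-𝒩[2+]⇒𝒫 (+ _)                  _  = next-injective 𝒫 ∘ next-injective ℛ
outcome-𝒩[2+]⇒𝒫 -[1+ 0 ]               _  ()
outcome-𝒩[2+]⇒𝒫 -[1+ 1 ]               () _
outcome-𝒩[2+]⇒𝒫 -[1+ suc (suc _) ]     () _

outcome-nonpositive≢𝒫 : ∀ m → outcome (- + m) ≢ 𝒫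
outcome-nonpositive≢𝒫 zero    ()
outcome-nonpositive≢𝒫 (suc _) ()

-- A Left move takes the weight d to d′ with Step d d′; a Right move from G to G′ is a Step
-- from weight G′ to weight G.
Step : ℤ → ℤ → Set
Step d d′ = d′ ≡ + 1 + d ⊎ d ≡ + 2 + d′

Step-to-𝒫-from-𝒩 : ∀ {d d′} → Step d d′ → outcome d′ ≡ 𝒫 → outcome d ≡ 𝒩
Step-to-𝒫-from-𝒩 {d} (inj₁ refl) = outcome-𝒫[1+]⇒𝒩 d
Step-to-𝒫-from-𝒩 {d′ = d′} (inj₂ refl) = outcome-𝒫⇒𝒩[2+] d′

stripWeight : ℕ → ℤ
stripWeight 0                   = + 0
stripWeight 1                   = -[1+ 0 ]
stripWeight 2                   = + 1
stripWeight (suc (suc (suc n))) = stripWeight n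

weight : Position → ℤ
weight []      = + 0
weight (n ∷ G) = stripWeight n + weight G

leftSplit-Step : ∀ a b → Step (stripWeight (a ℕ.+ suc b)) (stripWeight a + stripWeight b)
leftSplit-Step (suc (suc (suc a))) b       = leftSplit-Step a b
leftSplit-Step 0 (suc (suc (suc b)))       = leftSplit-Step 0 b
leftSplit-Step 1 (suc (suc (suc b)))       = leftSplit-Step 1 b
leftSplit-Step 2 (suc (suc (suc b)))       = leftSplit-Step 2 b
leftSplit-Step 0 0 = inj₁ refl
leftSplit-Step 0 1 = inj₂ refl
leftSplit-Step 0 2 = inj₁ refl
leftSplit-Step 1 0 = inj₂ refl
leftSplit-Step 1 1 = inj₂ refl
leftSplit-Step 1 2 = inj₁ refl
leftSplit-Step 2 0 = inj₁ refl
leftSplit-Step 2 1 = inj₁ refl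
leftSplit-Step 2 2 = inj₁ refl

rightSplit-Step : ∀ a b → Step (stripWeight a + stripWeight b) (stripWeight (a ℕ.+ suc (suc b)))
rightSplit-Step (suc (suc (suc a))) b      = rightSplit-Step a b
rightSplit-Step 0 (suc (suc (suc b)))      = rightSplit-Step 0 b
rightSplit-Step 1 (suc (suc (suc b)))      = rightSplit-Step 1 b
rightSplit-Step 2 (suc (suc (suc b)))      = rightSplit-Step 2 b
rightSplit-Step 0 0 = inj₁ refl
rightSplit-Step 0 1 = inj₁ refl
rightSplit-Step 0 2 = inj₂ refl
rightSplit-Step 1 0 = inj₁ refl
rightSplit-Step 1 1 = inj₁ refl
rightSplit-Step 1 2 = inj₁ refl
rightSplit-Step 2 0 = inj₂ refl
rightSplit-Step 2 1 = inj₁ refl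
rightSplit-Step 2 2 = inj₂ refl

weight-split : ∀ a b n G c → stripWeight a + stripWeight b ≡ c + stripWeight n →
               weight (a ∷ b ∷ G) ≡ c + weight (n ∷ G)
weight-split a b n G c e = begin
  stripWeight a + (stripWeight b + weight G)  ≡⟨ sym (+-assoc (stripWeight a) _ _) ⟩
  (stripWeight a + stripWeight b) + weight G  ≡⟨ cong (_+ weight G) e ⟩
  (c + stripWeight n) + weight G              ≡⟨ +-assoc c _ _ ⟩
  c + (stripWeight n + weight G)              ∎

weight-unsplit : ∀ a b n G c → stripWeight n ≡ c + (stripWeight a + stripWeight b) →
                 weight (n ∷ G) ≡ c + weight (a ∷ b ∷ G)
weight-unsplit a b n G c e = begin
  stripWeight n + weight G                          ≡⟨ cong (_+ weight G) e ⟩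
  (c + (stripWeight a + stripWeight b)) + weight G  ≡⟨ +-assoc c _ _ ⟩
  c + ((stripWeight a + stripWeight b) + weight G)  ≡⟨ cong (_+_ c) (+-assoc (stripWeight a) _ _) ⟩
  c + (stripWeight a + (stripWeight b + weight G))  ∎

weight-∷-shift : ∀ n G G′ c → weight G′ ≡ c + weight G → weight (n ∷ G′) ≡ c + weight (n ∷ G)
weight-∷-shift n G G′ c e =
  trans (cong (_+_ (stripWeight n)) e) (x∙yz≈y∙xz (stripWeight n) c (weight G))

weight-leftMove : ∀ {G G′} → LeftMove G G′ → Step (weight G) (weight G′)
weight-leftMove (here {G = G} a b refl) =
  Sum.map (weight-split a b (a ℕ.+ suc b) G (+ 1)) (weight-unsplit a b (a ℕ.+ suc b) G (+ 2))
          (leftSplit-Step a b)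
weight-leftMove (there {n} {G} {G′} m) =
  Sum.map (weight-∷-shift n G G′ (+ 1)) (weight-∷-shift n G′ G (+ 2)) (weight-leftMove m)

weight-rightMove : ∀ {G G′} → RightMove G G′ → Step (weight G′) (weight G)
weight-rightMove (here {G = G} a b refl) =
  Sum.map (weight-unsplit a b (a ℕ.+ suc (suc b)) G (+ 1))
          (weight-split a b (a ℕ.+ suc (suc b)) G (+ 2))
          (rightSplit-Step a b)
weight-rightMove (there {n} {G} {G′} m) =
  Sum.map (weight-∷-shift n G′ G (+ 1)) (weight-∷-shift n G G′ (+ 2)) (weight-rightMove m)

split-< : ∀ a b s → a ℕ.+ (b ℕ.+ s) < a ℕ.+ suc b ℕ.+ s
split-< a b s = ℕ.≤-reflexive (sym (trans (ℕ.+-assoc a (suc b) s) (ℕ.+-suc a (b ℕ.+ s))))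

sum-leftMove : ∀ {G G′} → LeftMove G G′ → sum G′ < sum G
sum-leftMove (here {G = G} a b refl) = split-< a b (sum G)
sum-leftMove (there {n} m)           = ℕ.+-monoʳ-< n (sum-leftMove m)

sum-rightMove : ∀ {G G′} → RightMove G G′ → sum G′ < sum G
sum-rightMove (here {G = G} a b refl) =
  ℕ.<-trans (ℕ.+-monoʳ-< a (ℕ.n<1+n _)) (split-< a (suc b) (sum G))
sum-rightMove (there {n} m)           = ℕ.+-monoʳ-< n (sum-rightMove m)

raisingLeftSplit : ∀ n →
  (∃₂ λ a b → a ℕ.+ suc b ≡ n × stripWeight a + stripWeight b ≡ + 1 + stripWeight n)
  ⊎ (n ≡ 0 ⊎ n ≡ 2)
raisingLeftSplit 0                   = inj₂ (inj₁ refl)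
raisingLeftSplit 1                   = inj₁ (0 , 0 , refl , refl)
raisingLeftSplit 2                   = inj₂ (inj₂ refl)
raisingLeftSplit (suc (suc (suc m))) = inj₁ (2 , m , refl , refl)

fallingRightSplit : ∀ n →
  (∃₂ λ a b → a ℕ.+ suc (suc b) ≡ n × stripWeight n ≡ + 1 + (stripWeight a + stripWeight b))
  ⊎ n < 2
fallingRightSplit 0                   = inj₂ (s≤s z≤n)
fallingRightSplit 1                   = inj₂ (s≤s (s≤s z≤n))
fallingRightSplit 2                   = inj₁ (0 , 0 , refl , refl)
fallingRightSplit (suc (suc (suc m))) = inj₁ (1 , m , refl , sym (begin
  + 1 + (-[1+ 0 ] + stripWeight m)  ≡⟨ sym (+-assoc (+ 1) -[1+ 0 ] (stripWeight m)) ⟩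
  + 0 + stripWeight m               ≡⟨ +-identityˡ _ ⟩
  stripWeight m                     ∎))

raisingLeftMove-or-all0or2 : ∀ G → (∃[ G′ ] LeftMove G G′ × weight G′ ≡ + 1 + weight G)
                                 ⊎ All (λ n → n ≡ 0 ⊎ n ≡ 2) G
raisingLeftMove-or-all0or2 [] = inj₂ []
raisingLeftMove-or-all0or2 (n ∷ G) with raisingLeftSplit n
... | inj₁ (a , b , refl , e) = inj₁ (a ∷ b ∷ G , here a b refl , weight-split a b n G (+ 1) e)
... | inj₂ n∈0,2 with raisingLeftMove-or-all0or2 G
...   | inj₁ (G′ , m , e) = inj₁ (n ∷ G′ , there m , weight-∷-shift n G G′ (+ 1) e)
...   | inj₂ all          = inj₂ (n∈0,2 ∷ all)

fallingRightMove-or-allShort : ∀ G → (∃[ G′ ] RightMove G G′ × weight G ≡ + 1 + weight G′)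
                                   ⊎ All (_< 2) G
fallingRightMove-or-allShort [] = inj₂ []
fallingRightMove-or-allShort (n ∷ G) with fallingRightSplit n
... | inj₁ (a , b , refl , e) = inj₁ (a ∷ b ∷ G , here a b refl , weight-unsplit a b n G (+ 1) e)
... | inj₂ n<2 with fallingRightMove-or-allShort G
...   | inj₁ (G′ , m , e) = inj₁ (n ∷ G′ , there m , weight-∷-shift n G′ G (+ 1) e)
...   | inj₂ all          = inj₂ (n<2 ∷ all)

weight-all0or2 : ∀ {G} → All (λ n → n ≡ 0 ⊎ n ≡ 2) G → ∃[ j ] weight G ≡ + j
weight-all0or2 []                = 0 , refl
weight-all0or2 (inj₁ refl ∷ all) = let j , e = weight-all0or2 all in j , trans (+-identityˡ _) e
weight-all0or2 (inj₂ refl ∷ all) = let j , e = weight-all0or2 all in suc j , cong (_+_ (+ 1)) e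

all0or2⇒leftStuck⊎loweringMove :
  ∀ {G} → All (λ n → n ≡ 0 ⊎ n ≡ 2) G →
  (∀ G′ → ¬ LeftMove G G′) ⊎
  (∃[ G′ ] LeftMove G G′ × weight G ≡ + 2 + weight G′ × ∃[ k ] weight G ≡ + suc k)
all0or2⇒leftStuck⊎loweringMove [] = inj₁ λ _ ()
all0or2⇒leftStuck⊎loweringMove {0 ∷ G} (inj₁ refl ∷ all) with all0or2⇒leftStuck⊎loweringMove all
... | inj₁ stuck = inj₁ λ where
  _        (here a _ e) → ℕ.m+1+n≢0 a e
  (_ ∷ G′) (there m)    → stuck G′ m
... | inj₂ (G′ , m , e , k , pos) =
  inj₂ (0 ∷ G′ , there m , weight-∷-shift 0 G′ G (+ 2) e , k , trans (+-identityˡ _) pos)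
all0or2⇒leftStuck⊎loweringMove {2 ∷ G} (inj₂ refl ∷ all) =
  let j , e = weight-all0or2 all in
  inj₂ (0 ∷ 1 ∷ G , here 0 1 refl , weight-unsplit 0 1 2 G (+ 2) refl ,
        j , cong (_+_ (+ 1)) e)

weight-allShort : ∀ {G} → All (_< 2) G → ∃[ m ] weight G ≡ - + m
weight-allShort []                    = 0 , refl
weight-allShort (s≤s z≤n ∷ all)       = let m , e = weight-allShort all in m , trans (+-identityˡ _) e
weight-allShort (s≤s (s≤s z≤n) ∷ all) with weight-allShort all
... | zero  , e = 1 , cong (_+_ -[1+ 0 ]) e
... | suc m , e = suc (suc m) , cong (_+_ -[1+ 0 ]) e

allShort⇒rightStuck : ∀ {G} → All (_< 2) G → ∀ G′ → ¬ RightMove G G′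
allShort⇒rightStuck (n<2 ∷ _) _ (here a b refl) =
  ℕ.<⇒≱ n<2 (ℕ.≤-trans (s≤s (s≤s z≤n)) (ℕ.m≤n+m (suc (suc b)) a))
allShort⇒rightStuck (_ ∷ all) (_ ∷ G′) (there m) = allShort⇒rightStuck all G′ m

leftMove-or-weight≡0 : ∀ G → ∃ (LeftMove G) ⊎ weight G ≡ + 0
leftMove-or-weight≡0 []          = inj₂ refl
leftMove-or-weight≡0 (suc k ∷ G) = inj₁ (0 ∷ k ∷ G , here 0 k refl)
leftMove-or-weight≡0 (zero ∷ G)  =
  Sum.map (λ (G′ , m) → 0 ∷ G′ , there m) (trans (+-identityˡ _)) (leftMove-or-weight≡0 G)

𝒩⇒leftStuck⊎leftMoveTo𝒫 : ∀ G → outcome (weight G) ≡ 𝒩 →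
  (∀ G′ → ¬ LeftMove G G′) ⊎ (∃[ G′ ] LeftMove G G′ × outcome (weight G′) ≡ 𝒫)
𝒩⇒leftStuck⊎leftMoveTo𝒫 G o with raisingLeftMove-or-all0or2 G
... | inj₁ (G′ , m , e) =
  inj₂ (G′ , m , trans (cong outcome e) (outcome-𝒩⇒𝒫[1+] (weight G) o))
... | inj₂ all with all0or2⇒leftStuck⊎loweringMove all
...   | inj₁ stuck = inj₁ stuck
...   | inj₂ (G′ , m , e , _ , pos) =
  inj₂ (G′ , m , outcome-𝒩[2+]⇒𝒫 (weight G′) (trans (sym e) pos)
                                    (trans (cong outcome (sym e)) o))

¬𝒫⇒rightStuck⊎rightMoveTo¬𝒩 : ∀ G → outcome (weight G) ≢ 𝒫 →
  (∀ G′ → ¬ RightMove G G′) ⊎ (∃[ G′ ] RightMove G G′ × outcome (weight G′) ≢ 𝒩)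
¬𝒫⇒rightStuck⊎rightMoveTo¬𝒩 G o with fallingRightMove-or-allShort G
... | inj₁ (G′ , m , e) =
  inj₂ (G′ , m , λ o′ → o (trans (cong outcome e) (outcome-𝒩⇒𝒫[1+] (weight G′) o′)))
... | inj₂ all          = inj₁ (allShort⇒rightStuck all)

¬𝒩⇒leftCanMove : ∀ G → outcome (weight G) ≢ 𝒩 → ∃ (LeftMove G)
¬𝒩⇒leftCanMove G o with leftMove-or-weight≡0 G
... | inj₁ move = move
... | inj₂ e    = ⊥-elim (o (cong outcome e))

𝒫⇒rightCanMove : ∀ G → outcome (weight G) ≡ 𝒫 → ∃ (RightMove G)
𝒫⇒rightCanMove G o with fallingRightMove-or-allShort G
... | inj₁ (G′ , m , _) = G′ , m
... | inj₂ all          =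
  let m , e = weight-allShort all in
  ⊥-elim (outcome-nonpositive≢𝒫 m (trans (cong outcome (sym e)) o))

mutual
  𝒩⇒leftWinsMovingFirst : ∀ {G} → Acc _<_ (sum G) → outcome (weight G) ≡ 𝒩 → LeftWinsMovingFirst G
  𝒩⇒leftWinsMovingFirst {G} (acc rs) o with 𝒩⇒leftStuck⊎leftMoveTo𝒫 G o
  ... | inj₁ stuck          = leftStuck stuck
  ... | inj₂ (G′ , m , o′) = leftGood G′ m (𝒫⇒leftWinsMovingSecond (rs (sum-leftMove m)) o′)

  ¬𝒩⇒rightWinsMovingSecond : ∀ {G} → Acc _<_ (sum G) → outcome (weight G) ≢ 𝒩 → RightWinsMovingSecond G
  ¬𝒩⇒rightWinsMovingSecond {G} (acc rs) o = leftAllBad (¬𝒩⇒leftCanMove G o) λ G′ m →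
    ¬𝒫⇒rightWinsMovingFirst (rs (sum-leftMove m)) (o ∘ Step-to-𝒫-from-𝒩 (weight-leftMove m))

  𝒫⇒leftWinsMovingSecond : ∀ {G} → Acc _<_ (sum G) → outcome (weight G) ≡ 𝒫 → LeftWinsMovingSecond G
  𝒫⇒leftWinsMovingSecond {G} (acc rs) o = rightAllBad (𝒫⇒rightCanMove G o) λ G′ m →
    𝒩⇒leftWinsMovingFirst (rs (sum-rightMove m)) (Step-to-𝒫-from-𝒩 (weight-rightMove m) o)

  ¬𝒫⇒rightWinsMovingFirst : ∀ {G} → Acc _<_ (sum G) → outcome (weight G) ≢ 𝒫 → RightWinsMovingFirst G
  ¬𝒫⇒rightWinsMovingFirst {G} (acc rs) o with ¬𝒫⇒rightStuck⊎rightMoveTo¬𝒩 G o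
  ... | inj₁ stuck          = rightStuck stuck
  ... | inj₂ (G′ , m , o′) = rightGood G′ m (¬𝒩⇒rightWinsMovingSecond (rs (sum-rightMove m)) o′)

mutual
  leftWinsFirst⇒¬rightWinsSecond : ∀ {G} → LeftWinsMovingFirst G → ¬ RightWinsMovingSecond G
  leftWinsFirst⇒¬rightWinsSecond (leftStuck stuck) (leftAllBad (G′ , m) _) = stuck G′ m
  leftWinsFirst⇒¬rightWinsSecond (leftGood G′ m win) (leftAllBad _ reply) =
    rightWinsFirst⇒¬leftWinsSecond (reply G′ m) win

  rightWinsFirst⇒¬leftWinsSecond : ∀ {G} → RightWinsMovingFirst G → ¬ LeftWinsMovingSecond G
  rightWinsFirst⇒¬leftWinsSecond (rightStuck stuck) (rightAllBad (G′ , m) _) = stuck G′ m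
  rightWinsFirst⇒¬leftWinsSecond (rightGood G′ m win) (rightAllBad _ reply) =
    leftWinsFirst⇒¬rightWinsSecond (reply G′ m) win

leftWinsMovingFirst⇔𝒩 : ∀ G → LeftWinsMovingFirst G ⇔ (outcome (weight G) ≡ 𝒩)
leftWinsMovingFirst⇔𝒩 G =
  (λ win → decidable-stable (outcome (weight G) ≟𝒩) λ o →
     leftWinsFirst⇒¬rightWinsSecond win (¬𝒩⇒rightWinsMovingSecond (<-wellFounded _) o)) ,
  𝒩⇒leftWinsMovingFirst (<-wellFounded _)

rightWinsMovingFirst⇔¬𝒫 : ∀ G → RightWinsMovingFirst G ⇔ (outcome (weight G) ≢ 𝒫)
rightWinsMovingFirst⇔¬𝒫 G =
  (λ win o → rightWinsFirst⇒¬leftWinsSecond win (𝒫⇒leftWinsMovingSecond (<-wellFounded _) o)) ,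
  ¬𝒫⇒rightWinsMovingFirst (<-wellFounded _)

⇔-trans : ∀ {A B C : Set} → A ⇔ B → B ⇔ C → A ⇔ C
⇔-trans (f , f⁻) (g , g⁻) = g ∘ f , f⁻ ∘ g⁻

⇔-sym : ∀ {A B : Set} → A ⇔ B → B ⇔ A
⇔-sym (f , f⁻) = f⁻ , f

subst-⇔ : ∀ (P : Outcome → Set) {o o′} → o ≡ o′ → P o ⇔ P o′
subst-⇔ P e = subst P e , subst P (sym e)

sameOutcome⇒sameMisereOutcome : ∀ G H → outcome (weight G) ≡ outcome (weight H) → SameMisereOutcome G H
sameOutcome⇒sameMisereOutcome G H e =
  ⇔-trans (leftWinsMovingFirst⇔𝒩 G) (⇔-trans (subst-⇔ (_≡ 𝒩) e) (⇔-sym (leftWinsMovingFirst⇔𝒩 H))) ,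
  ⇔-trans (rightWinsMovingFirst⇔¬𝒫 G) (⇔-trans (subst-⇔ (_≢ 𝒫) e) (⇔-sym (rightWinsMovingFirst⇔¬𝒫 H)))

weight-S1⊕S2⊕ : ∀ X → weight ((S 1 ⊕ S 2) ⊕ X) ≡ weight X
weight-S1⊕S2⊕ X = trans (sym (+-assoc -[1+ 0 ] (+ 1) (weight X))) (+-identityˡ (weight X))

corollary4p2 : (S 1 ⊕ S 2) ≡mod𝒦 𝟎
corollary4p2 X = sameOutcome⇒sameMisereOutcome ((S 1 ⊕ S 2) ⊕ X) X (cong outcome (weight-S1⊕S2⊕ X))
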